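{- Let $\{A_n\}_{n\ge 0}$ be the sequence of Apéry numbers, defined by $A_0=1$, $A_1=5$ and, for $n\ge 2$, $$n^3 A_n = (34n^3-51n^2+27n-5)A_{n-1} - (n-1)^3 A_{n-2}.$$ Then $\{A_n\}_{n\ge 0}$ is ratio log-concave, that is, for all integers $n\ge 2$, $$\left(\frac{A_n}{A_{n-1}}\right)^2 \ge \frac{A_{n-1}}{A_{n-2}}\cdot\frac{A_{n+1}}{A_n}.$$
   Context: A real sequence $\{S_n\}$ is called ratio log-concave if the sequence of ratios $\{S_n/S_{n-1}\}$ is log-concave. -}

module Defs where

open import Data.Nat as ℕ using (ℕ; zero; suc)
open import Data.Integer using (+_)
open import Data.Rational using (ℚ; 0ℚ; 1ℚ; _+_; _-_; _*_; _÷_; _/_; _≟_; _≤_; ≢-nonZero)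
open import Relation.Nullary using (yes; no)

⟦_⟧ : ℕ → ℚ
⟦ n ⟧ = (+ n) / 1

-- total division on ℚ (convention p ⊘ 0 = 0; only ever applied to
-- nonzero divisors in the statement, where it is the usual quotient)
_⊘_ : ℚ → ℚ → ℚ
p ⊘ q with q ≟ 0ℚ
... | yes _ = 0ℚ
... | no q≢0 = _÷_ p q {{≢-nonZero q≢0}}

apery : ℕ → ℚ
apery zero = 1ℚ
apery (suc zero) = ⟦ 5 ⟧
apery (suc (suc m)) =
  ((⟦ 34 ⟧ * n * n * n - ⟦ 51 ⟧ * n * n + ⟦ 27 ⟧ * n - ⟦ 5 ⟧) * apery (suc m)
    - (n - 1ℚ) * (n - 1ℚ) * (n - 1ℚ) * apery m)
  ⊘ (n * n * n)
  where
  n : ℚ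
  n = ⟦ suc (suc m) ⟧

RatioLogConcave : (ℕ → ℚ) → Set
RatioLogConcave S =
  ∀ (n : ℕ) → 2 ℕ.≤ n →
    ((S (n ℕ.∸ 1) ⊘ S (n ℕ.∸ 2)) * (S (suc n) ⊘ S n))
      ≤ ((S n ⊘ S (n ℕ.∸ 1)) * (S n ⊘ S (n ℕ.∸ 1)))

module Submission where

-- Ratio log-concavity at n is A_{n-1}³ A_{n+1} ≤ A_n³ A_{n-2}.  We prove, by induction on n ≥ 2,
-- that 0 < A_{n-1} ≤ A_n and G n A_n A_{n-1} ≥ 0; by the recurrence the latter says that the
-- ratios x_n = A_n / A_{n-1} satisfy x_n / x_{n-1} ≥ C n / (2n³).  After clearing the denominators
-- n³, (n ± 1)³ and eliminating the outer terms by the recurrence, both the induction step and the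
-- final inequality are polynomial identities expressing the target as a combination of G,
-- A_n - A_{n-1} and A_{n-1} whose coefficients are polynomials in n.  These coefficients are
-- nonnegative for n ≥ 2 since their expansions in powers of n - 2 have nonnegative coefficients.

open import Data.List using (List; []; _∷_)
open import Data.Nat as ℕ using (ℕ; zero; suc)
import Data.Nat.Properties as ℕ

-- The polynomials are defined over an arbitrary Arithmetic so that the same definitions yield
-- functions on ℚ and formal polynomials for the ring solver.  (The operations of ℚ are opened
-- only below, since they share the names of the fields.)
record Arithmetic (A : Set) : Set where
  infixl 6 _+_ _-_
  infixl 7 _*_
  field
    _+_ _-_ _*_ : A → A → A
    num : ℕ → A

module ApéryPolynomials {A : Set} (arithmetic : Arithmetic A) where
  open Arithmetic arithmetic

  cube : A → A
  cube x = x * x * x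

  P : A → A
  P n = num 34 * n * n * n - num 51 * n * n + num 27 * n - num 5

  C : A → A
  C n = num 2 * n * n * n + num 3 * n + num 3

  G : A → A → A → A
  G n a b = num 2 * cube n * P n * a * b - num 2 * cube n * cube n * a * a - cube (n - num 1) * C n * b * b

  Ĝ : A → A → A → A
  Ĝ n x b = num 2 * P n * x * b - num 2 * x * x - cube (n - num 1) * C n * b * b

  -- (n+1)³ (n-1)³ (a³ c - b³ d) for consecutive terms c, b, a, d of the recurrence, after
  -- c and d are eliminated.
  Q : A → A → A → A
  Q n a b = cube (n + num 1) * a * a * a * (P n * b - a * cube n)
            - cube (n - num 1) * b * b * b * (P (n + num 1) * a - cube (n + num 1 - num 1) * b)

  K : A → A
  K n = num 2 * cube n * (num 2 * cube n * P (n + num 1) - P n * C (n + num 1))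

  L : A → A
  L n = num 2 * cube n * P n * cube (n + num 1) * C n - num 4 * cube n * cube n * cube n * P (n + num 1)

  horner : List ℕ → A → A
  horner []       x = num 0
  horner (k ∷ ks) x = num k + x * horner ks x

import Data.Integer as ℤ
import Data.Integer.Properties as ℤ
import Data.Nat.Coprimality as Coprime
open import Data.Rational
  using (ℚ; mkℚ; *≤*; 0ℚ; 1ℚ; _+_; _-_; _*_; -_; 1/_; _≤_; _<_; _≟_; ≢-nonZero; toℚᵘ; positive; nonNegative)
open import Data.Rational.Properties
  using ( <⇒≤; <⇒≢; <-≤-trans; _≤?_; +-mono-≤; +-monoˡ-≤; +-mono-<-≤; *-cancelˡ-≤-pos
        ; +-assoc; +-identityˡ; +-identityʳ; +-inverseˡ; +-inverseʳ; *-assoc; *-zeroʳ; *-identityʳ; *-inverseˡ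
        ; nonNeg*nonNeg⇒nonNeg; pos*pos⇒pos; positive⁻¹; nonNegative⁻¹; normalize-nonNeg; normalize-pos
        ; normalize-coprime; toℚᵘ-injective; toℚᵘ-fromℚᵘ; toℚᵘ-homo-+)
import Data.Rational.Unnormalised as ℚᵘ
import Data.Rational.Unnormalised.Properties as ℚᵘ
open import Data.Rational.Solver using (module +-*-Solver)
open +-*-Solver using (Polynomial; con; _:+_; _:-_; _:*_; _:=_; solve)
open import Data.Empty using (⊥-elim)
open import Data.Unit using (tt)
open import Relation.Binary.PropositionalEquality
open import Relation.Nullary using (yes; no)
open import Relation.Nullary.Decidable using (toWitness)

open import Defs

nonNeg-+ : ∀ {p q} → 0ℚ ≤ p → 0ℚ ≤ q → 0ℚ ≤ p + q
nonNeg-+ {p} {q} 0≤p 0≤q = subst (_≤ p + q) (+-identityˡ 0ℚ) (+-mono-≤ 0≤p 0≤q)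

pos-+ : ∀ {p q} → 0ℚ < p → 0ℚ ≤ q → 0ℚ < p + q
pos-+ {p} {q} 0<p 0≤q = subst (_< p + q) (+-identityˡ 0ℚ) (+-mono-<-≤ 0<p 0≤q)

nonNeg-* : ∀ {p q} → 0ℚ ≤ p → 0ℚ ≤ q → 0ℚ ≤ p * q
nonNeg-* {p} {q} 0≤p 0≤q =
  nonNegative⁻¹ (p * q) {{nonNeg*nonNeg⇒nonNeg p {{nonNegative 0≤p}} q {{nonNegative 0≤q}}}}

pos-* : ∀ {p q} → 0ℚ < p → 0ℚ < q → 0ℚ < p * q
pos-* {p} {q} 0<p 0<q = positive⁻¹ (p * q) {{pos*pos⇒pos p {{positive 0<p}} q {{positive 0<q}}}}

nonNeg-cancelˡ-pos : ∀ {r p} → 0ℚ < r → 0ℚ ≤ r * p → 0ℚ ≤ p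
nonNeg-cancelˡ-pos {r} {p} 0<r 0≤rp =
  *-cancelˡ-≤-pos r {{positive 0<r}} (subst (_≤ r * p) (sym (*-zeroʳ r)) 0≤rp)

p≤q⇒0≤q-p : ∀ {p q} → p ≤ q → 0ℚ ≤ q - p
p≤q⇒0≤q-p {p} {q} p≤q = subst (_≤ q - p) (+-inverseʳ p) (+-monoˡ-≤ (- p) p≤q)

0≤q-p⇒p≤q : ∀ {p q} → 0ℚ ≤ q - p → p ≤ q
0≤q-p⇒p≤q {p} {q} 0≤q-p = subst₂ _≤_ (+-identityˡ p) q-p+p≡q (+-monoˡ-≤ p 0≤q-p)
  where
  q-p+p≡q : q - p + p ≡ q
  q-p+p≡q = trans (+-assoc q (- p) p) (trans (cong (λ x → q + x) (+-inverseˡ p)) (+-identityʳ q))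

⊘-*-cancel : ∀ p q → 0ℚ < q → (p ⊘ q) * q ≡ p
⊘-*-cancel p q 0<q with q ≟ 0ℚ
... | yes q≡0 = ⊥-elim (<⇒≢ 0<q (sym q≡0))
... | no q≢0  = trans (*-assoc p (1/ q) q) (trans (cong (p *_) (*-inverseˡ q)) (*-identityʳ p))
  where instance _ = ≢-nonZero q≢0

⟦⟧-nonNeg : ∀ k → 0ℚ ≤ ⟦ k ⟧
⟦⟧-nonNeg k = nonNegative⁻¹ ⟦ k ⟧ {{normalize-nonNeg k 1}}

⟦⟧-pos : ∀ k → 0ℚ < ⟦ suc k ⟧
⟦⟧-pos k = positive⁻¹ ⟦ suc k ⟧ {{normalize-pos (suc k) 1}}

⟦⟧-mono-≤ : ∀ {m n} → m ℕ.≤ n → ⟦ m ⟧ ≤ ⟦ n ⟧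
⟦⟧-mono-≤ {m} {n} m≤n = subst₂ _≤_ (mkℚ≡⟦⟧ m) (mkℚ≡⟦⟧ n)
  (*≤* (subst₂ ℤ._≤_ (sym (ℤ.*-identityʳ (ℤ.+ m))) (sym (ℤ.*-identityʳ (ℤ.+ n))) (ℤ.+≤+ m≤n)))
  where
  mkℚ≡⟦⟧ : ∀ k → mkℚ (ℤ.+ k) 0 (Coprime.sym (Coprime.1-coprimeTo k)) ≡ ⟦ k ⟧
  mkℚ≡⟦⟧ k = sym (normalize-coprime (Coprime.sym (Coprime.1-coprimeTo k)))

⟦suc⟧ : ∀ k → ⟦ suc k ⟧ ≡ ⟦ k ⟧ + 1ℚ
⟦suc⟧ k = toℚᵘ-injective (begin-equality
  toℚᵘ ⟦ suc k ⟧                    ≃⟨ toℚᵘ-fromℚᵘ (ℚᵘ.mkℚᵘ (ℤ.+ suc k) 0) ⟩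
  ℚᵘ.mkℚᵘ (ℤ.+ suc k) 0             ≃⟨ ℚᵘ.*≡* (cong (ℤ._* ℤ.+ 1) 1+k≡k*1+1) ⟩
  k/1 ℚᵘ.+ ℚᵘ.1ℚᵘ                  ≃⟨ ℚᵘ.+-congˡ ℚᵘ.1ℚᵘ (ℚᵘ.≃-sym (toℚᵘ-fromℚᵘ k/1)) ⟩
  toℚᵘ ⟦ k ⟧ ℚᵘ.+ toℚᵘ 1ℚ           ≃⟨ ℚᵘ.≃-sym (toℚᵘ-homo-+ ⟦ k ⟧ 1ℚ) ⟩
  toℚᵘ (⟦ k ⟧ + 1ℚ)                 ∎)
  where
  open ℚᵘ.≤-Reasoning
  k/1 : ℚᵘ.ℚᵘ
  k/1 = ℚᵘ.mkℚᵘ (ℤ.+ k) 0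
  1+k≡k*1+1 : ℤ.+ suc k ≡ ℤ.+ k ℤ.* ℤ.+ 1 ℤ.+ ℤ.+ 1
  1+k≡k*1+1 = trans (cong ℤ.+_ (ℕ.+-comm 1 k)) (cong (ℤ._+ ℤ.+ 1) (sym (ℤ.*-identityʳ (ℤ.+ k))))

ℚ-arithmetic : Arithmetic ℚ
ℚ-arithmetic = record { _+_ = _+_ ; _-_ = _-_ ; _*_ = _*_ ; num = ⟦_⟧ }

polynomial-arithmetic : ∀ {n} → Arithmetic (Polynomial n)
polynomial-arithmetic = record { _+_ = _:+_ ; _-_ = _:-_ ; _*_ = _:*_ ; num = λ k → con ⟦ k ⟧ }

open ApéryPolynomials ℚ-arithmetic

module Formal {n} = ApéryPolynomials (polynomial-arithmetic {n})

cube-pos : ∀ {x} → 0ℚ < x → 0ℚ < cube x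
cube-pos 0<x = pos-* (pos-* 0<x 0<x) 0<x

horner-nonNeg : ∀ ks {x} → 0ℚ ≤ x → 0ℚ ≤ horner ks x
horner-nonNeg []       0≤x = ⟦⟧-nonNeg 0
horner-nonNeg (k ∷ ks) 0≤x = nonNeg-+ (⟦⟧-nonNeg k) (nonNeg-* 0≤x (horner-nonNeg ks 0≤x))

horner-pos : ∀ k ks {x} → 0ℚ ≤ x → 0ℚ < horner (suc k ∷ ks) x
horner-pos k ks 0≤x = pos-+ (⟦⟧-pos k) (nonNeg-* 0≤x (horner-nonNeg ks 0≤x))

nonNeg-by-certificate : ∀ {f : ℚ → ℚ} ks → (∀ N → f N ≡ horner ks (N - ⟦ 2 ⟧)) →
                        ∀ {N} → ⟦ 2 ⟧ ≤ N → 0ℚ ≤ f N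
nonNeg-by-certificate ks f≡ {N} 2≤N = subst (0ℚ ≤_) (sym (f≡ N)) (horner-nonNeg ks (p≤q⇒0≤q-p 2≤N))

pos-by-certificate : ∀ {f : ℚ → ℚ} k ks → (∀ N → f N ≡ horner (suc k ∷ ks) (N - ⟦ 2 ⟧)) →
                     ∀ {N} → ⟦ 2 ⟧ ≤ N → 0ℚ < f N
pos-by-certificate k ks f≡ {N} 2≤N = subst (0ℚ <_) (sym (f≡ N)) (horner-pos k ks (p≤q⇒0≤q-p 2≤N))

module _ {N : ℚ} (2≤N : ⟦ 2 ⟧ ≤ N) where

  N-pos : 0ℚ < N
  N-pos = pos-by-certificate 1 (1 ∷ [])
    (solve 1 (λ x → x := Formal.horner (2 ∷ 1 ∷ []) (x :- con ⟦ 2 ⟧)) refl) 2≤N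

  N-1-pos : 0ℚ < N - 1ℚ
  N-1-pos = pos-by-certificate 0 (1 ∷ [])
    (solve 1 (λ x → x :- con 1ℚ := Formal.horner (1 ∷ 1 ∷ []) (x :- con ⟦ 2 ⟧)) refl) 2≤N

  N+1-pos : 0ℚ < N + 1ℚ
  N+1-pos = pos-by-certificate 2 (1 ∷ [])
    (solve 1 (λ x → x :+ con 1ℚ := Formal.horner (3 ∷ 1 ∷ []) (x :- con ⟦ 2 ⟧)) refl) 2≤N

  C-suc-nonNeg : 0ℚ ≤ C (N + 1ℚ)
  C-suc-nonNeg = nonNeg-by-certificate ks
    (solve 1 (λ x → Formal.C (x :+ con 1ℚ) := Formal.horner ks (x :- con ⟦ 2 ⟧)) refl) 2≤N
    where ks = 66 ∷ 57 ∷ 18 ∷ 2 ∷ []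

  P-suc-excess : 0ℚ ≤ P (N + 1ℚ) - cube N - cube (N + 1ℚ)
  P-suc-excess = nonNeg-by-certificate ks
    (solve 1 (λ x → Formal.P (x :+ con 1ℚ) :- Formal.cube x :- Formal.cube (x :+ con 1ℚ)
                    := Formal.horner ks (x :- con ⟦ 2 ⟧)) refl) 2≤N
    where ks = 500 ∷ 600 ∷ 240 ∷ 32 ∷ []

  C-excess : 0ℚ ≤ ⟦ 2 ⟧ * cube N * cube N - cube (N - 1ℚ) * C N
  C-excess = nonNeg-by-certificate ks
    (solve 1 (λ x → con ⟦ 2 ⟧ :* Formal.cube x :* Formal.cube x :- Formal.cube (x :- con 1ℚ) :* Formal.C x
                    := Formal.horner ks (x :- con ⟦ 2 ⟧)) refl) 2≤N
    where ks = 103 ∷ 282 ∷ 312 ∷ 176 ∷ 51 ∷ 6 ∷ []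

  K-nonNeg : 0ℚ ≤ K N
  K-nonNeg = nonNeg-by-certificate ks
    (solve 1 (λ x → Formal.K x := Formal.horner ks (x :- con ⟦ 2 ⟧)) refl) 2≤N
    where ks = 13408 ∷ 38496 ∷ 45072 ∷ 27344 ∷ 8958 ∷ 1470 ∷ 90 ∷ []

  K-excess : 0ℚ ≤ K N - ⟦ 4 ⟧ * cube N * cube N * cube N + C (N + 1ℚ) * cube (N - 1ℚ) * C N
  K-excess = nonNeg-by-certificate ks
    (solve 1 (λ x → Formal.K x :- con ⟦ 4 ⟧ :* Formal.cube x :* Formal.cube x :* Formal.cube x
                    :+ Formal.C (x :+ con 1ℚ) :* Formal.cube (x :- con 1ℚ) :* Formal.C x
                    := Formal.horner ks (x :- con ⟦ 2 ⟧)) refl) 2≤N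
    where ks = 13010 ∷ 37437 ∷ 43992 ∷ 26806 ∷ 8820 ∷ 1455 ∷ 90 ∷ []

  L-nonNeg : 0ℚ ≤ L N
  L-nonNeg = nonNeg-by-certificate ks
    (solve 1 (λ x → Formal.L x := Formal.horner ks (x :- con ⟦ 2 ⟧)) refl) 2≤N
    where ks = 167920 ∷ 779256 ∷ 1593948 ∷ 1885858 ∷ 1422078 ∷ 708714 ∷ 233416 ∷ 48990 ∷ 5946 ∷ 318 ∷ []

  L-excess : 0ℚ ≤ L N + ⟦ 4 ⟧ * cube N * cube N * cube N * cube N - cube (N + 1ℚ) * cube (N - 1ℚ) * C N * C N
  L-excess = nonNeg-by-certificate ks
    (solve 1 (λ x → Formal.L x :+ con ⟦ 4 ⟧ :* Formal.cube x :* Formal.cube x :* Formal.cube x :* Formal.cube x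
                    :- Formal.cube (x :+ con 1ℚ) :* Formal.cube (x :- con 1ℚ) :* Formal.C x :* Formal.C x
                    := Formal.horner ks (x :- con ⟦ 2 ⟧)) refl) 2≤N
    where ks = 167429 ∷ 773610 ∷ 1575726 ∷ 1856840 ∷ 1394886 ∷ 692604 ∷ 227270 ∷ 47520 ∷ 5745 ∷ 306 ∷ []

G-scaled : ∀ n a b → G n a b ≡ Ĝ n (a * cube n) b
G-scaled = solve 3 (λ n a b → Formal.G n a b := Formal.Ĝ n (a :* Formal.cube n) b) refl

G-step-identity : ∀ N a b →
  ⟦ 2 ⟧ * cube N * cube N * Ĝ (N + 1ℚ) (P (N + 1ℚ) * a - cube (N + 1ℚ - 1ℚ) * b) a ≡
  cube N * (C (N + 1ℚ) * G N a b + b * K N * (a - b)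
            + b * b * (K N - ⟦ 4 ⟧ * cube N * cube N * cube N + C (N + 1ℚ) * cube (N - 1ℚ) * C N))
G-step-identity = solve 3 (λ N a b →
  con ⟦ 2 ⟧ :* Formal.cube N :* Formal.cube N
    :* Formal.Ĝ (N :+ con 1ℚ) (Formal.P (N :+ con 1ℚ) :* a :- Formal.cube (N :+ con 1ℚ :- con 1ℚ) :* b) a
  := Formal.cube N :* (Formal.C (N :+ con 1ℚ) :* Formal.G N a b :+ b :* Formal.K N :* (a :- b)
       :+ b :* b :* (Formal.K N :- con ⟦ 4 ⟧ :* Formal.cube N :* Formal.cube N :* Formal.cube N
                     :+ Formal.C (N :+ con 1ℚ) :* Formal.cube (N :- con 1ℚ) :* Formal.C N))) refl

growth-identity : ∀ N a b →
  P (N + 1ℚ) * a - cube (N + 1ℚ - 1ℚ) * b - cube (N + 1ℚ) * a ≡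
  (P (N + 1ℚ) - cube N - cube (N + 1ℚ)) * a + cube N * (a - b)
growth-identity = solve 3 (λ N a b →
  Formal.P (N :+ con 1ℚ) :* a :- Formal.cube (N :+ con 1ℚ :- con 1ℚ) :* b :- Formal.cube (N :+ con 1ℚ) :* a
  := (Formal.P (N :+ con 1ℚ) :- Formal.cube N :- Formal.cube (N :+ con 1ℚ)) :* a :+ Formal.cube N :* (a :- b)) refl

quartic-identity : ∀ N a b →
  ⟦ 4 ⟧ * cube N * cube N * cube N * Q N a b ≡
  G N a b * (⟦ 2 ⟧ * cube N * cube N * cube (N + 1ℚ) * (a - b) * (a + b)
             + cube (N + 1ℚ) * b * b * (⟦ 2 ⟧ * cube N * cube N - cube (N - 1ℚ) * C N))
  + b * b * b * cube (N - 1ℚ)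
    * (L N * (a - b) + (L N + ⟦ 4 ⟧ * cube N * cube N * cube N * cube N
                        - cube (N + 1ℚ) * cube (N - 1ℚ) * C N * C N) * b)
quartic-identity = solve 3 (λ N a b →
  con ⟦ 4 ⟧ :* Formal.cube N :* Formal.cube N :* Formal.cube N :* Formal.Q N a b
  := Formal.G N a b
       :* (con ⟦ 2 ⟧ :* Formal.cube N :* Formal.cube N :* Formal.cube (N :+ con 1ℚ) :* (a :- b) :* (a :+ b)
           :+ Formal.cube (N :+ con 1ℚ) :* b :* b
              :* (con ⟦ 2 ⟧ :* Formal.cube N :* Formal.cube N :- Formal.cube (N :- con 1ℚ) :* Formal.C N))
     :+ b :* b :* b :* Formal.cube (N :- con 1ℚ)
        :* (Formal.L N :* (a :- b)
            :+ (Formal.L N :+ con ⟦ 4 ⟧ :* Formal.cube N :* Formal.cube N :* Formal.cube N :* Formal.cube N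
                :- Formal.cube (N :+ con 1ℚ) :* Formal.cube (N :- con 1ℚ) :* Formal.C N :* Formal.C N) :* b)) refl

*-distribˡ-- : ∀ k d a → k * (d - a) ≡ d * k - k * a
*-distribˡ-- = solve 3 (λ k d a → k :* (d :- a) := d :* k :- k :* a) refl

p≡q-r⇒r≡q-p : ∀ {p q r} → p ≡ q - r → r ≡ q - p
p≡q-r⇒r≡q-p {p} {q} {r} p≡q-r = trans (sym (q-[q-r]≡r q r)) (cong (λ x → q - x) (sym p≡q-r))
  where
  q-[q-r]≡r : ∀ q r → q - (q - r) ≡ r
  q-[q-r]≡r = solve 2 (λ q r → q :- (q :- r) := r) refl

record Invariant (N a b : ℚ) : Set where
  field
    0<b : 0ℚ < b
    b≤a : b ≤ a
    0≤G : 0ℚ ≤ G N a b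

  0<a : 0ℚ < a
  0<a = <-≤-trans 0<b b≤a

  0≤a : 0ℚ ≤ a
  0≤a = <⇒≤ 0<a

  0≤b : 0ℚ ≤ b
  0≤b = <⇒≤ 0<b

  0≤a-b : 0ℚ ≤ a - b
  0≤a-b = p≤q⇒0≤q-p b≤a

invariant-suc : ∀ {N a b d} → ⟦ 2 ⟧ ≤ N → Invariant N a b →
                d * cube (N + 1ℚ) ≡ P (N + 1ℚ) * a - cube (N + 1ℚ - 1ℚ) * b →
                Invariant (N + 1ℚ) d a
invariant-suc {N} {a} {b} {d} 2≤N inv rec = record { 0<b = 0<a ; b≤a = a≤d ; 0≤G = 0≤G′ }
  where
  open Invariant inv
  open ≡-Reasoning

  N³-pos : 0ℚ < cube N
  N³-pos = cube-pos (N-pos 2≤N)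

  growth : cube (N + 1ℚ) * (d - a) ≡ (P (N + 1ℚ) - cube N - cube (N + 1ℚ)) * a + cube N * (a - b)
  growth = begin
    cube (N + 1ℚ) * (d - a)                                      ≡⟨ *-distribˡ-- (cube (N + 1ℚ)) d a ⟩
    d * cube (N + 1ℚ) - cube (N + 1ℚ) * a                        ≡⟨ cong (_- cube (N + 1ℚ) * a) rec ⟩
    P (N + 1ℚ) * a - cube (N + 1ℚ - 1ℚ) * b - cube (N + 1ℚ) * a  ≡⟨ growth-identity N a b ⟩
    (P (N + 1ℚ) - cube N - cube (N + 1ℚ)) * a + cube N * (a - b) ∎

  a≤d : a ≤ d
  a≤d = 0≤q-p⇒p≤q (nonNeg-cancelˡ-pos (cube-pos (N+1-pos 2≤N)) (subst (0ℚ ≤_) (sym growth)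
          (nonNeg-+ (nonNeg-* (P-suc-excess 2≤N) 0≤a) (nonNeg-* (<⇒≤ N³-pos) 0≤a-b))))

  step : ⟦ 2 ⟧ * cube N * cube N * G (N + 1ℚ) d a ≡
         cube N * (C (N + 1ℚ) * G N a b + b * K N * (a - b)
                   + b * b * (K N - ⟦ 4 ⟧ * cube N * cube N * cube N + C (N + 1ℚ) * cube (N - 1ℚ) * C N))
  step = begin
    ⟦ 2 ⟧ * cube N * cube N * G (N + 1ℚ) d a
      ≡⟨ cong (⟦ 2 ⟧ * cube N * cube N *_) (G-scaled (N + 1ℚ) d a) ⟩
    ⟦ 2 ⟧ * cube N * cube N * Ĝ (N + 1ℚ) (d * cube (N + 1ℚ)) a
      ≡⟨ cong (λ x → ⟦ 2 ⟧ * cube N * cube N * Ĝ (N + 1ℚ) x a) rec ⟩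
    ⟦ 2 ⟧ * cube N * cube N * Ĝ (N + 1ℚ) (P (N + 1ℚ) * a - cube (N + 1ℚ - 1ℚ) * b) a
      ≡⟨ G-step-identity N a b ⟩
    _ ∎

  0≤G′ : 0ℚ ≤ G (N + 1ℚ) d a
  0≤G′ = nonNeg-cancelˡ-pos (pos-* (pos-* (⟦⟧-pos 1) N³-pos) N³-pos)
    (subst (0ℚ ≤_) (sym step) (nonNeg-* (<⇒≤ N³-pos)
      (nonNeg-+ (nonNeg-+ (nonNeg-* (C-suc-nonNeg 2≤N) 0≤G) (nonNeg-* (nonNeg-* 0≤b (K-nonNeg 2≤N)) 0≤a-b))
                (nonNeg-* (nonNeg-* 0≤b 0≤b) (K-excess 2≤N)))))

Q-nonNeg : ∀ {N a b} → ⟦ 2 ⟧ ≤ N → Invariant N a b → 0ℚ ≤ Q N a b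
Q-nonNeg {N} {a} {b} 2≤N inv = nonNeg-cancelˡ-pos 4N⁹-pos (subst (0ℚ ≤_) (sym (quartic-identity N a b))
  (nonNeg-+ (nonNeg-* 0≤G (nonNeg-+ (nonNeg-* (nonNeg-* (<⇒≤ 2N⁶[N+1]³-pos) 0≤a-b) (nonNeg-+ 0≤a 0≤b))
                                    (nonNeg-* (nonNeg-* (nonNeg-* 0≤[N+1]³ 0≤b) 0≤b) (C-excess 2≤N))))
            (nonNeg-* (nonNeg-* (nonNeg-* (nonNeg-* 0≤b 0≤b) 0≤b) (<⇒≤ (cube-pos (N-1-pos 2≤N))))
                      (nonNeg-+ (nonNeg-* (L-nonNeg 2≤N) 0≤a-b) (nonNeg-* (L-excess 2≤N) 0≤b)))))
  where
  open Invariant inv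

  N³-pos : 0ℚ < cube N
  N³-pos = cube-pos (N-pos 2≤N)

  4N⁹-pos : 0ℚ < ⟦ 4 ⟧ * cube N * cube N * cube N
  4N⁹-pos = pos-* (pos-* (pos-* (⟦⟧-pos 3) N³-pos) N³-pos) N³-pos

  0≤[N+1]³ : 0ℚ ≤ cube (N + 1ℚ)
  0≤[N+1]³ = <⇒≤ (cube-pos (N+1-pos 2≤N))

  2N⁶[N+1]³-pos : 0ℚ < ⟦ 2 ⟧ * cube N * cube N * cube (N + 1ℚ)
  2N⁶[N+1]³-pos = pos-* (pos-* (pos-* (⟦⟧-pos 1) N³-pos) N³-pos) (cube-pos (N+1-pos 2≤N))

cubes-inequality : ∀ {N a b c d} → ⟦ 2 ⟧ ≤ N → Invariant N a b →
                   a * cube N ≡ P N * b - cube (N - 1ℚ) * c →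
                   d * cube (N + 1ℚ) ≡ P (N + 1ℚ) * a - cube (N + 1ℚ - 1ℚ) * b →
                   b * b * b * d ≤ a * a * a * c
cubes-inequality {N} {a} {b} {c} {d} 2≤N inv rec rec′ =
  0≤q-p⇒p≤q (nonNeg-cancelˡ-pos (pos-* (cube-pos (N+1-pos 2≤N)) (cube-pos (N-1-pos 2≤N)))
    (subst (0ℚ ≤_) (sym eliminate) (Q-nonNeg 2≤N inv)))
  where
  clear-denominators : ∀ N a b c d →
    cube (N + 1ℚ) * cube (N - 1ℚ) * (a * a * a * c - b * b * b * d) ≡
    cube (N + 1ℚ) * a * a * a * (cube (N - 1ℚ) * c) - cube (N - 1ℚ) * b * b * b * (d * cube (N + 1ℚ))
  clear-denominators = solve 5 (λ N a b c d →
    Formal.cube (N :+ con 1ℚ) :* Formal.cube (N :- con 1ℚ) :* (a :* a :* a :* c :- b :* b :* b :* d)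
    := Formal.cube (N :+ con 1ℚ) :* a :* a :* a :* (Formal.cube (N :- con 1ℚ) :* c)
       :- Formal.cube (N :- con 1ℚ) :* b :* b :* b :* (d :* Formal.cube (N :+ con 1ℚ))) refl

  eliminate : cube (N + 1ℚ) * cube (N - 1ℚ) * (a * a * a * c - b * b * b * d) ≡ Q N a b
  eliminate = trans (clear-denominators N a b c d)
    (cong₂ (λ x y → cube (N + 1ℚ) * a * a * a * x - cube (N - 1ℚ) * b * b * b * y)
           (p≡q-r⇒r≡q-p {q = P N * b} {r = cube (N - 1ℚ) * c} rec) rec′)

ratios-log-concave : ∀ {a b c d} → 0ℚ < a → 0ℚ < b → 0ℚ < c →
                     b * b * b * d ≤ a * a * a * c → (b ⊘ c) * (d ⊘ a) ≤ (a ⊘ b) * (a ⊘ b)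
ratios-log-concave {a} {b} {c} {d} 0<a 0<b 0<c b³d≤a³c =
  0≤q-p⇒p≤q (nonNeg-cancelˡ-pos (pos-* (pos-* (pos-* 0<c 0<a) 0<b) 0<b)
    (subst (0ℚ ≤_) (sym clear-denominators) (p≤q⇒0≤q-p b³d≤a³c)))
  where
  open ≡-Reasoning

  expand : ∀ u v w a b c → c * a * b * b * (w * w - u * v) ≡ w * b * (w * b) * c * a - u * c * (v * a) * b * b
  expand = solve 6 (λ u v w a b c →
    c :* a :* b :* b :* (w :* w :- u :* v) := w :* b :* (w :* b) :* c :* a :- u :* c :* (v :* a) :* b :* b) refl

  rearrange : ∀ a b c d → a * a * c * a - b * d * b * b ≡ a * a * a * c - b * b * b * d
  rearrange = solve 4 (λ a b c d →
    a :* a :* c :* a :- b :* d :* b :* b := a :* a :* a :* c :- b :* b :* b :* d) refl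

  clear-denominators : c * a * b * b * ((a ⊘ b) * (a ⊘ b) - (b ⊘ c) * (d ⊘ a)) ≡ a * a * a * c - b * b * b * d
  clear-denominators = begin
    c * a * b * b * ((a ⊘ b) * (a ⊘ b) - (b ⊘ c) * (d ⊘ a))
      ≡⟨ expand (b ⊘ c) (d ⊘ a) (a ⊘ b) a b c ⟩
    (a ⊘ b) * b * ((a ⊘ b) * b) * c * a - (b ⊘ c) * c * ((d ⊘ a) * a) * b * b
      ≡⟨ cong₂ (λ x y → x * x * c * a - y * b * b)
               (⊘-*-cancel a b 0<b) (cong₂ _*_ (⊘-*-cancel b c 0<c) (⊘-*-cancel d a 0<a)) ⟩
    a * a * c * a - b * d * b * b
      ≡⟨ rearrange a b c d ⟩
    a * a * a * c - b * b * b * d ∎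

2≤⟦2+m⟧ : ∀ m → ⟦ 2 ⟧ ≤ ⟦ suc (suc m) ⟧
2≤⟦2+m⟧ m = ⟦⟧-mono-≤ {2} {suc (suc m)} (ℕ.s≤s (ℕ.s≤s ℕ.z≤n))

-- The index is taken through an equation so that the recurrence can also be used at ⟦ 2 + m ⟧ + 1ℚ.
apery-recurrence : ∀ m {N} → N ≡ ⟦ suc (suc m) ⟧ →
                   apery (suc (suc m)) * cube N ≡ P N * apery (suc m) - cube (N - 1ℚ) * apery m
apery-recurrence m refl =
  ⊘-*-cancel (P N * apery (suc m) - cube (N - 1ℚ) * apery m) (cube N) (cube-pos (N-pos (2≤⟦2+m⟧ m)))
  where
  N : ℚ
  N = ⟦ suc (suc m) ⟧

invariant : ∀ m → Invariant ⟦ suc (suc m) ⟧ (apery (suc (suc m))) (apery (suc m))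
invariant zero = record
  { 0<b = ⟦⟧-pos 4
  ; b≤a = toWitness {a? = apery 1 ≤? apery 2} tt
  ; 0≤G = toWitness {a? = 0ℚ ≤? G ⟦ 2 ⟧ (apery 2) (apery 1)} tt
  }
invariant (suc m) = subst (λ N → Invariant N (apery (3 ℕ.+ m)) (apery (2 ℕ.+ m))) (sym (⟦suc⟧ (2 ℕ.+ m)))
  (invariant-suc (2≤⟦2+m⟧ m) (invariant m) (apery-recurrence (suc m) (sym (⟦suc⟧ (2 ℕ.+ m)))))

apery-pos : ∀ m → 0ℚ < apery m
apery-pos zero    = ⟦⟧-pos 0
apery-pos (suc m) = Invariant.0<b (invariant m)

theorem1p4 : RatioLogConcave apery
theorem1p4 (suc zero)    (ℕ.s≤s ())
theorem1p4 (suc (suc m)) _ =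
  ratios-log-concave (apery-pos (2 ℕ.+ m)) (apery-pos (1 ℕ.+ m)) (apery-pos m)
    (cubes-inequality (2≤⟦2+m⟧ m) (invariant m)
      (apery-recurrence m refl) (apery-recurrence (suc m) (sym (⟦suc⟧ (2 ℕ.+ m)))))
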